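{- Let $q$ be an odd prime power, $\mathbb{F}_q$ the field with $q$ elements, and let $d,k\ge 1$. Let $h_1(\mathbf{x}),\ldots,h_k(\mathbf{x})\in\mathbb{F}_q[x_1,\ldots,x_d]$ be fixed polynomials of degree at most $q-1$, and let $\mathbf{b}_i=(b_{i1},\ldots,b_{id})\in(\mathbb{Z}^+)^d$ ($1\le i\le k$) be fixed vectors with $\gcd(b_{ij},q-1)=1$ for all $i,j$. For $\mathbf{a}_i=(a_{i1},\ldots,a_{id},a_{i(d+1)})\in\mathbb{F}_q^{d+1}$ put $$f_i(\mathbf{x},\mathbf{a}_i)=h_i(\mathbf{x})+\sum_{j=1}^d a_{ij}x_j^{b_{ij}}+a_{i(d+1)},$$ and $$V_{\mathbf{a}_1,\ldots,\mathbf{a}_k}=\{(\mathbf{x},x_{d+1},\ldots,x_{d+k})\in\mathbb{F}_q^{d+k}: x_{d+i}=f_i(\mathbf{x},\mathbf{a}_i)\text{ for all }1\le i\le k\}.$$ Let $\mathcal{P}$ be a set of points in $\mathbb{F}_q^d\times\mathbb{F}_q^k$ and $\mathcal{V}$ a set of varieties of the form $V_{\mathbf{a}_1,\ldots,\mathbf{a}_k}$. Then the number $I(\mathcal{P},\mathcal{V})=|\{(p,v)\in\mathcal{P}\times\mathcal{V}: p\in v\}|$ of incidences satisfies $$\left|I(\mathcal{P},\mathcal{V})-\frac{|\mathcal{P}||\mathcal{V}|}{q^k}\right|\le q^{dk/2}\sqrt{|\mathcal{P}||\mathcal{V}|}.$$ -}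

module Defs where

open import Level using (Level; suc; _⊔_)
open import Data.Nat as ℕ using (ℕ; _∸_; _≤_)
open import Data.Nat.Primality using (Prime)
open import Data.Nat.GCD using (gcd)
open import Data.Integer as ℤ using (ℤ)
open import Data.Bool using (Bool; true; false)
open import Data.Fin using (Fin; inject₁; fromℕ)
open import Data.Vec as Vec using (Vec; lookup; tabulate)
import Data.Vec.Properties as VecP
open import Data.List as List using (List; length; filter; cartesianProduct)
open import Data.List.Membership.Propositional using (_∈_)
open import Data.List.Relation.Unary.Unique.Propositional using (Unique)
open import Data.Product using (_×_; _,_; ∃; ∃-syntax; proj₁; proj₂)
open import Relation.Binary.PropositionalEquality using (_≡_; _≢_)
open import Relation.Binary.Definitions using (DecidableEquality)
open import Relation.Nullary using (Dec; yes; no)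
open import Algebra.Structures using (IsCommutativeRing)

record FiniteField (c : Level) : Set (suc c) where
  infixl 6 _+_
  infixl 7 _*_
  field
    Carrier : Set c
    _+_ _*_ : Carrier → Carrier → Carrier
    -_      : Carrier → Carrier
    0# 1#   : Carrier
    isCommutativeRing : IsCommutativeRing _≡_ _+_ _*_ -_ 0# 1#
    0≢1     : 0# ≢ 1#
    inverse : ∀ x → x ≢ 0# → ∃[ y ] (x * y ≡ 1#)
    _≟_     : DecidableEquality Carrier
    elements : List Carrier
    elements-unique   : Unique elements
    elements-complete : ∀ x → x ∈ elements

  size : ℕ
  size = length elements

  _^_ : Carrier → ℕ → Carrier
  x ^ ℕ.zero  = 1#
  x ^ ℕ.suc n = x * (x ^ n)

  sumFin : ∀ {n} → (Fin n → Carrier) → Carrier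
  sumFin {n} f = Vec.foldr _ _+_ 0# (tabulate f)

  prodFin : ∀ {n} → (Fin n → Carrier) → Carrier
  prodFin {n} f = Vec.foldr _ _*_ 1# (tabulate f)

OddPrimePower : ℕ → Set
OddPrimePower q = ∃[ p ] ∃[ m ] (Prime p × 1 ≤ m × (p ℕ.% 2 ≡ 1) × q ≡ p ℕ.^ m)

module _ {c} (F : FiniteField c) where
  open FiniteField F

  Monomial : ℕ → Set
  Monomial d = Vec ℕ d

  Poly : ℕ → Set c
  Poly d = List (Carrier × Monomial d)

  totalDegree : ∀ {d} → Monomial d → ℕ
  totalDegree e = Vec.sum e

  DegreeAtMost : ∀ {d} → ℕ → Poly d → Set c
  DegreeAtMost {d} D h = ∀ {a e} → (a , e) ∈ h → a ≢ 0# → totalDegree e ≤ D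

  evalMonomial : ∀ {d} → Monomial d → Vec Carrier d → Carrier
  evalMonomial e x = prodFin (λ j → lookup x j ^ lookup e j)

  eval : ∀ {d} → Poly d → Vec Carrier d → Carrier
  eval List.[] x = 0#
  eval ((a , e) List.∷ h) x = a * evalMonomial e x + eval h x

  module Setup {d k : ℕ}
               (h : Fin k → Poly d)
               (b : Fin k → Vec ℕ d) where

    -- parameter tuple (a_1,…,a_k), a_i ∈ F^{d+1}; a_i at index fromℕ d is a_{i(d+1)}
    Param : Set c
    Param = Vec (Vec Carrier (ℕ.suc d)) k

    f : Fin k → Vec Carrier d → Vec Carrier (ℕ.suc d) → Carrier
    f i x a = eval (h i) x
              + sumFin (λ j → lookup a (inject₁ j) * (lookup x j ^ lookup (b i) j))
              + lookup a (fromℕ d)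

    Point : Set c
    Point = Vec Carrier d × Vec Carrier k

    _∈V_ : Point → Param → Set c
    (x , y) ∈V a = y ≡ tabulate (λ i → f i x (lookup a i))

    _∈V?_ : ∀ p a → Dec (p ∈V a)
    (x , y) ∈V? a = VecP.≡-dec _≟_ y (tabulate (λ i → f i x (lookup a i)))

    incidences : List Point → List Param → ℕ
    incidences P V = length (filter (λ pa → proj₁ pa ∈V? proj₂ pa) (cartesianProduct P V))

module Submission where

open import Defs
open import Level using (Level)
open import Data.Nat as ℕ using (ℕ; _≤_; _∸_)
open import Data.Nat.GCD using (gcd)
open import Data.Integer as ℤ using (ℤ; +_)
open import Data.Fin using (Fin)
open import Data.Vec using (Vec; lookup)
open import Data.List using (List; length)
open import Data.List.Relation.Unary.Unique.Propositional using (Unique)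
open import Relation.Binary.PropositionalEquality using (_≡_)

open import Algebra.Bundles using (CommutativeSemiring; CommutativeRing)
open import Algebra.Core using (Op₂)
import Algebra.Properties.CommutativeSemigroup as CommutativeSemigroupProperties
import Algebra.Properties.Group as GroupProperties
open import Algebra.Structures using (IsCommutativeSemiring)
import Data.Fin as Fin
import Data.Integer.Properties as ℤₚ
open import Data.Integer.Tactic.RingSolver using (solve-∀)
open import Data.List as List using ([]; _∷_; _++_; map; concatMap; filter; cartesianProduct)
open import Data.List.Membership.Propositional using (_∈_)
open import Data.List.Membership.Propositional.Properties
  using (∈-++⁺ˡ; ∈-++⁺ʳ; ∈-++⁻; ∈-map⁺; ∈-map⁻; ∈-∃++; ∈-concatMap⁺; ∈-filter⁺; ∈-filter⁻)
open import Data.List.Membership.Propositional.Properties.WithK using (unique∧set⇒bag)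
open import Data.List.Relation.Binary.BagAndSetEquality using (∼bag⇒↭)
open import Data.List.Relation.Binary.Permutation.Propositional using (_↭_; ↭⇒↭ₛ)
import Data.List.Relation.Binary.Permutation.Setoid.Properties as PermutationProperties
import Data.List.Relation.Unary.All as All
open import Data.List.Relation.Unary.AllPairs using ([]; _∷_)
import Data.List.Relation.Unary.Any as Any
open import Data.List.Relation.Unary.Any using (here; there)
import Data.List.Relation.Unary.Unique.Propositional.Properties as Uniqueₚ
open import Data.Nat using (zero; suc; z≤n; s≤s)
open import Data.Nat.GCD using (GCD; gcd-GCD; module Bézout)
import Data.Nat.Properties as ℕₚ
open import Data.Product using (_×_; _,_; proj₁; proj₂; uncurry)
open import Data.Product.Properties using () renaming (≡-dec to ×-≡-dec)
open import Data.Sum using (inj₁; inj₂)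
open import Data.Vec using ([]; _∷_; _∷ʳ_; tabulate)
import Data.Vec.Properties as Vecₚ
open import Function using (_∘_)
open import Function.Bundles using (mk⇔)
open import Relation.Binary.Definitions using (DecidableEquality)
open import Relation.Binary.PropositionalEquality
  using (refl; sym; trans; cong; cong₂; subst; subst₂; _≢_; module ≡-Reasoning)
import Relation.Binary.PropositionalEquality as ≡
open import Relation.Nullary using (Dec; yes; no; ¬_; ¬?; _×-dec_)
open import Relation.Nullary.Negation using (contradiction)

open import Algebra.Properties.CommutativeMonoid.Sum ℕₚ.*-1-commutativeMonoid
  using () renaming (sum to ∏; ∑-distrib-+ to ∏-distrib-*; sum-cong-≗ to ∏-cong)

-- Let N(a) count the points of P on the variety with parameters a, for a in the whole
-- parameter space Ω = (F_q^{d+1})^k. Then q^k I - |P||V| = Σ_{a∈V} (q^k N(a) - |P|), so by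
-- Cauchy–Schwarz it suffices to show Σ_{a∈Ω} (q^k N(a) - |P|)² ≤ q^{dk+2k} |P|, which follows
-- from the first two moments of N. Since f_i is a translate in the constant coefficient
-- a_{i(d+1)}, every point lies on exactly q^{dk} varieties. Points (x, y) ≠ (x', y') with x = x'
-- share no variety. If x ≠ x', then (x_j^{b_ij})_j ≠ (x'_j^{b_ij})_j because z ↦ z^b is injective
-- on F_q when gcd(b, q - 1) = 1; eliminating a_{i(d+1)} from the two incidence equations leaves
-- a proper affine hyperplane in the remaining d coordinates of a_i, so the two points share at
-- most q^{(d-1)k} varieties.

-- Sums over lists

module ListSum {a} {A : Set a} {+ᴬ *ᴬ : Op₂ A} {0ᴬ 1ᴬ : A}
               (isCommutativeSemiring : IsCommutativeSemiring _≡_ +ᴬ *ᴬ 0ᴬ 1ᴬ) where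
  private
    R : CommutativeSemiring a a
    R = record { isCommutativeSemiring = isCommutativeSemiring }
  open CommutativeSemiring R
    using (_+_; _*_; 0#; +-assoc; +-identityˡ; zeroˡ; zeroʳ; distribˡ; distribʳ; +-commutativeSemigroup)
  open import Algebra.Properties.CommutativeSemigroup +-commutativeSemigroup using (interchange)
  private variable
    ℓ ℓ′ : Level
    X : Set ℓ
    Y : Set ℓ′

  ∑ : List X → (X → A) → A
  ∑ []       f = 0#
  ∑ (x ∷ xs) f = f x + ∑ xs f

  syntax ∑ xs (λ x → e) = ∑[ x ∈ xs ] e

  ∑-cong : ∀ xs {f g : X → A} → (∀ x → f x ≡ g x) → ∑ xs f ≡ ∑ xs g
  ∑-cong []       f≗g = refl
  ∑-cong (x ∷ xs) f≗g = cong₂ _+_ (f≗g x) (∑-cong xs f≗g)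

  ∑-zero : ∀ (xs : List X) → ∑[ x ∈ xs ] 0# ≡ 0#
  ∑-zero []       = refl
  ∑-zero (x ∷ xs) = trans (+-identityˡ _) (∑-zero xs)

  ∑-distrib-+ : ∀ xs (f g : X → A) → ∑[ x ∈ xs ] (f x + g x) ≡ ∑ xs f + ∑ xs g
  ∑-distrib-+ []       f g = sym (+-identityˡ 0#)
  ∑-distrib-+ (x ∷ xs) f g =
    trans (cong (_+_ (f x + g x)) (∑-distrib-+ xs f g)) (interchange (f x) (g x) (∑ xs f) (∑ xs g))

  ∑-distribˡ : ∀ xs c (f : X → A) → ∑[ x ∈ xs ] (c * f x) ≡ c * ∑ xs f
  ∑-distribˡ []       c f = sym (zeroʳ c)
  ∑-distribˡ (x ∷ xs) c f = trans (cong (_+_ (c * f x)) (∑-distribˡ xs c f)) (sym (distribˡ c (f x) _))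

  ∑-distribʳ : ∀ xs c (f : X → A) → ∑[ x ∈ xs ] (f x * c) ≡ ∑ xs f * c
  ∑-distribʳ []       c f = sym (zeroˡ c)
  ∑-distribʳ (x ∷ xs) c f = trans (cong (_+_ (f x * c)) (∑-distribʳ xs c f)) (sym (distribʳ c (f x) _))

  ∑-++ : ∀ xs ys (f : X → A) → ∑ (xs ++ ys) f ≡ ∑ xs f + ∑ ys f
  ∑-++ []       ys f = sym (+-identityˡ _)
  ∑-++ (x ∷ xs) ys f = trans (cong (_+_ (f x)) (∑-++ xs ys f)) (sym (+-assoc (f x) _ _))

  ∑-map : ∀ xs (g : X → Y) (f : Y → A) → ∑ (map g xs) f ≡ ∑ xs (f ∘ g)
  ∑-map []       g f = refl
  ∑-map (x ∷ xs) g f = cong (_+_ (f (g x))) (∑-map xs g f)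

  ∑-concatMap : ∀ xs (g : X → List Y) (f : Y → A) → ∑ (concatMap g xs) f ≡ ∑[ x ∈ xs ] ∑ (g x) f
  ∑-concatMap []       g f = refl
  ∑-concatMap (x ∷ xs) g f = trans (∑-++ (g x) _ f) (cong (_+_ (∑ (g x) f)) (∑-concatMap xs g f))

  ∑-comm : ∀ xs ys (f : X → Y → A) → ∑[ x ∈ xs ] ∑[ y ∈ ys ] f x y ≡ ∑[ y ∈ ys ] ∑[ x ∈ xs ] f x y
  ∑-comm []       ys f = sym (∑-zero ys)
  ∑-comm (x ∷ xs) ys f = trans (cong (_+_ (∑ ys (f x))) (∑-comm xs ys f))
                               (sym (∑-distrib-+ ys (f x) (λ y → ∑[ x ∈ xs ] f x y)))

  ∑-cartesianProduct : ∀ xs ys (f : X × Y → A) → ∑ (cartesianProduct xs ys) f ≡ ∑[ x ∈ xs ] ∑[ y ∈ ys ] f (x , y)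
  ∑-cartesianProduct []       ys f = refl
  ∑-cartesianProduct (x ∷ xs) ys f =
    trans (∑-++ (map (x ,_) ys) _ f) (cong₂ _+_ (∑-map ys (x ,_) f) (∑-cartesianProduct xs ys f))

open ListSum ℕₚ.+-*-isCommutativeSemiring
module ℤ∑ = ListSum ℤₚ.+-*-isCommutativeSemiring

module _ {ℓ} {X : Set ℓ} where

  ∑-const : ∀ (xs : List X) c → ∑[ x ∈ xs ] c ≡ length xs ℕ.* c
  ∑-const []       c = refl
  ∑-const (x ∷ xs) c = cong (c ℕ.+_) (∑-const xs c)

  ∑-mono-≤ : ∀ xs {f g : X → ℕ} → (∀ x → f x ≤ g x) → ∑ xs f ≤ ∑ xs g
  ∑-mono-≤ []       f≤g = z≤n
  ∑-mono-≤ (x ∷ xs) f≤g = ℕₚ.+-mono-≤ (f≤g x) (∑-mono-≤ xs f≤g)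

  length≡∑1 : ∀ (xs : List X) → length xs ≡ ∑[ x ∈ xs ] 1
  length≡∑1 xs = sym (trans (∑-const xs 1) (ℕₚ.*-identityʳ _))

0≤i*i : ∀ (i : ℤ) → ℤ.0ℤ ℤ.≤ i ℤ.* i
0≤i*i (+ n)     = subst (ℤ.0ℤ ℤ.≤_) (ℤₚ.pos-* n n) (ℤ.+≤+ z≤n)
0≤i*i ℤ.-[1+ n ] = ℤ.+≤+ z≤n

module _ {ℓ} {X : Set ℓ} where

  pos-∑ : ∀ xs (f : X → ℕ) → + ∑ xs f ≡ ℤ∑.∑[ x ∈ xs ] (+ f x)
  pos-∑ []       f = refl
  pos-∑ (x ∷ xs) f = trans (ℤₚ.pos-+ (f x) (∑ xs f)) (cong (ℤ._+_ (+ f x)) (pos-∑ xs f))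

  ℤ∑-nonNeg : ∀ xs {f : X → ℤ} → (∀ x → ℤ.0ℤ ℤ.≤ f x) → ℤ.0ℤ ℤ.≤ ℤ∑.∑ xs f
  ℤ∑-nonNeg []       0≤f = ℤₚ.≤-refl
  ℤ∑-nonNeg (x ∷ xs) 0≤f = ℤₚ.+-mono-≤ (0≤f x) (ℤ∑-nonNeg xs 0≤f)

  ℤ∑-affine : ∀ xs (κ e : ℤ) (F : X → ℤ) →
              ℤ∑.∑[ x ∈ xs ] (κ ℤ.* F x ℤ.- e) ≡ κ ℤ.* ℤ∑.∑ xs F ℤ.- + length xs ℤ.* e
  ℤ∑-affine []       κ e F = empty κ e
    where
    empty : ∀ κ e → ℤ.0ℤ ≡ κ ℤ.* ℤ.0ℤ ℤ.- ℤ.0ℤ ℤ.* e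
    empty = solve-∀
  ℤ∑-affine (x ∷ xs) κ e F = begin
    κ ℤ.* F x ℤ.- e ℤ.+ ℤ∑.∑[ x ∈ xs ] (κ ℤ.* F x ℤ.- e)
      ≡⟨ cong (ℤ._+_ (κ ℤ.* F x ℤ.- e)) (ℤ∑-affine xs κ e F) ⟩
    κ ℤ.* F x ℤ.- e ℤ.+ (κ ℤ.* ℤ∑.∑ xs F ℤ.- + length xs ℤ.* e)
      ≡⟨ regroup κ e (F x) (ℤ∑.∑ xs F) (+ length xs) ⟩
    κ ℤ.* (F x ℤ.+ ℤ∑.∑ xs F) ℤ.- (+ 1 ℤ.+ + length xs) ℤ.* e
      ≡⟨ cong (λ n → κ ℤ.* (F x ℤ.+ ℤ∑.∑ xs F) ℤ.- n ℤ.* e) (sym (ℤₚ.pos-+ 1 (length xs))) ⟩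
    κ ℤ.* (F x ℤ.+ ℤ∑.∑ xs F) ℤ.- + length (x ∷ xs) ℤ.* e
      ∎
    where
    open ≡-Reasoning
    regroup : ∀ κ e f s n → κ ℤ.* f ℤ.- e ℤ.+ (κ ℤ.* s ℤ.- n ℤ.* e) ≡ κ ℤ.* (f ℤ.+ s) ℤ.- (+ 1 ℤ.+ n) ℤ.* e
    regroup = solve-∀

  ℤ∑-square : ∀ xs (κ e : ℤ) (F : X → ℤ) →
    ℤ∑.∑[ x ∈ xs ] ((κ ℤ.* F x ℤ.- e) ℤ.* (κ ℤ.* F x ℤ.- e))
      ≡ κ ℤ.* κ ℤ.* ℤ∑.∑[ x ∈ xs ] (F x ℤ.* F x) ℤ.- + 2 ℤ.* κ ℤ.* e ℤ.* ℤ∑.∑ xs F ℤ.+ + length xs ℤ.* (e ℤ.* e)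
  ℤ∑-square []       κ e F = empty κ e
    where
    empty : ∀ κ e → ℤ.0ℤ ≡ κ ℤ.* κ ℤ.* ℤ.0ℤ ℤ.- + 2 ℤ.* κ ℤ.* e ℤ.* ℤ.0ℤ ℤ.+ ℤ.0ℤ ℤ.* (e ℤ.* e)
    empty = solve-∀
  ℤ∑-square (x ∷ xs) κ e F = begin
    (κ ℤ.* F x ℤ.- e) ℤ.* (κ ℤ.* F x ℤ.- e) ℤ.+ ℤ∑.∑[ x ∈ xs ] ((κ ℤ.* F x ℤ.- e) ℤ.* (κ ℤ.* F x ℤ.- e))
      ≡⟨ cong (ℤ._+_ ((κ ℤ.* F x ℤ.- e) ℤ.* (κ ℤ.* F x ℤ.- e))) (ℤ∑-square xs κ e F) ⟩
    (κ ℤ.* F x ℤ.- e) ℤ.* (κ ℤ.* F x ℤ.- e) ℤ.+ (κ ℤ.* κ ℤ.* S₂ ℤ.- + 2 ℤ.* κ ℤ.* e ℤ.* S₁ ℤ.+ + length xs ℤ.* (e ℤ.* e))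
      ≡⟨ regroup κ e (F x) S₂ S₁ (+ length xs) ⟩
    κ ℤ.* κ ℤ.* (F x ℤ.* F x ℤ.+ S₂) ℤ.- + 2 ℤ.* κ ℤ.* e ℤ.* (F x ℤ.+ S₁) ℤ.+ (+ 1 ℤ.+ + length xs) ℤ.* (e ℤ.* e)
      ≡⟨ cong (λ n → κ ℤ.* κ ℤ.* (F x ℤ.* F x ℤ.+ S₂) ℤ.- + 2 ℤ.* κ ℤ.* e ℤ.* (F x ℤ.+ S₁) ℤ.+ n ℤ.* (e ℤ.* e))
              (sym (ℤₚ.pos-+ 1 (length xs))) ⟩
    κ ℤ.* κ ℤ.* (F x ℤ.* F x ℤ.+ S₂) ℤ.- + 2 ℤ.* κ ℤ.* e ℤ.* (F x ℤ.+ S₁) ℤ.+ + length (x ∷ xs) ℤ.* (e ℤ.* e)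
      ∎
    where
    open ≡-Reasoning
    S₁ = ℤ∑.∑ xs F
    S₂ = ℤ∑.∑[ x ∈ xs ] (F x ℤ.* F x)
    regroup : ∀ κ e f S₂ S₁ n →
      (κ ℤ.* f ℤ.- e) ℤ.* (κ ℤ.* f ℤ.- e) ℤ.+ (κ ℤ.* κ ℤ.* S₂ ℤ.- + 2 ℤ.* κ ℤ.* e ℤ.* S₁ ℤ.+ n ℤ.* (e ℤ.* e))
        ≡ κ ℤ.* κ ℤ.* (f ℤ.* f ℤ.+ S₂) ℤ.- + 2 ℤ.* κ ℤ.* e ℤ.* (f ℤ.+ S₁) ℤ.+ (+ 1 ℤ.+ n) ℤ.* (e ℤ.* e)
    regroup = solve-∀

  cauchy-schwarz : ∀ xs (g : X → ℤ) →
    ℤ∑.∑ xs g ℤ.* ℤ∑.∑ xs g ℤ.≤ + length xs ℤ.* ℤ∑.∑[ x ∈ xs ] (g x ℤ.* g x)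
  cauchy-schwarz []       g = ℤₚ.≤-refl
  cauchy-schwarz (x ∷ xs) g = begin
    (a ℤ.+ S₁) ℤ.* (a ℤ.+ S₁)
      ≤⟨ ℤₚ.i≤i+j _ _ {{ℤ.nonNegative (ℤₚ.+-mono-≤ (ℤₚ.i≤j⇒0≤j-i (cauchy-schwarz xs g)) 0≤∑[g-a]²)}} ⟩
    (a ℤ.+ S₁) ℤ.* (a ℤ.+ S₁) ℤ.+ ((n ℤ.* S₂ ℤ.- S₁ ℤ.* S₁) ℤ.+ ∑[g-a]²)
      ≡⟨ cong (λ t → (a ℤ.+ S₁) ℤ.* (a ℤ.+ S₁) ℤ.+ ((n ℤ.* S₂ ℤ.- S₁ ℤ.* S₁) ℤ.+ t)) (ℤ∑-square xs (+ 1) a g) ⟩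
    (a ℤ.+ S₁) ℤ.* (a ℤ.+ S₁) ℤ.+ ((n ℤ.* S₂ ℤ.- S₁ ℤ.* S₁)
      ℤ.+ (+ 1 ℤ.* + 1 ℤ.* S₂ ℤ.- + 2 ℤ.* + 1 ℤ.* a ℤ.* S₁ ℤ.+ n ℤ.* (a ℤ.* a)))
      ≡⟨ regroup a S₁ S₂ n ⟩
    (+ 1 ℤ.+ n) ℤ.* (a ℤ.* a ℤ.+ S₂)
      ≡⟨ cong (ℤ._* (a ℤ.* a ℤ.+ S₂)) (sym (ℤₚ.pos-+ 1 (length xs))) ⟩
    + length (x ∷ xs) ℤ.* (a ℤ.* a ℤ.+ S₂)
      ∎
    where
    open ℤₚ.≤-Reasoning
    a  = g x
    n  = + length xs
    S₁ = ℤ∑.∑ xs g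
    S₂ = ℤ∑.∑[ y ∈ xs ] (g y ℤ.* g y)
    ∑[g-a]² = ℤ∑.∑[ y ∈ xs ] ((+ 1 ℤ.* g y ℤ.- a) ℤ.* (+ 1 ℤ.* g y ℤ.- a))
    0≤∑[g-a]² : ℤ.0ℤ ℤ.≤ ∑[g-a]²
    0≤∑[g-a]² = ℤ∑-nonNeg xs (λ y → 0≤i*i (+ 1 ℤ.* g y ℤ.- a))
    regroup : ∀ a S₁ S₂ n →
      (a ℤ.+ S₁) ℤ.* (a ℤ.+ S₁) ℤ.+ ((n ℤ.* S₂ ℤ.- S₁ ℤ.* S₁)
        ℤ.+ (+ 1 ℤ.* + 1 ℤ.* S₂ ℤ.- + 2 ℤ.* + 1 ℤ.* a ℤ.* S₁ ℤ.+ n ℤ.* (a ℤ.* a)))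
        ≡ (+ 1 ℤ.+ n) ℤ.* (a ℤ.* a ℤ.+ S₂)
    regroup = solve-∀

  ℤ∑-⊆-≤ : ∀ {xs ys} {f : X → ℤ} → Unique xs → (∀ x → x ∈ xs → x ∈ ys) → (∀ x → ℤ.0ℤ ℤ.≤ f x) →
           ℤ∑.∑ xs f ℤ.≤ ℤ∑.∑ ys f
  ℤ∑-⊆-≤ {[]}     {ys}     _              _     0≤f = ℤ∑-nonNeg ys 0≤f
  ℤ∑-⊆-≤ {x ∷ xs} {ys} {f} (x∉xs ∷ !xs) xxs⊆ys 0≤f with ∈-∃++ (xxs⊆ys x (here refl))
  ... | ys₁ , ys₂ , refl = begin
    f x ℤ.+ ℤ∑.∑ xs f               ≤⟨ ℤₚ.+-monoʳ-≤ (f x) (ℤ∑-⊆-≤ !xs xs⊆ys₁ys₂ 0≤f) ⟩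
    f x ℤ.+ ℤ∑.∑ (ys₁ ++ ys₂) f     ≡⟨ ℤ∑-middle ⟨
    ℤ∑.∑ (ys₁ ++ x ∷ ys₂) f         ∎
    where
    open ℤₚ.≤-Reasoning
    xs⊆ys₁ys₂ : ∀ y → y ∈ xs → y ∈ ys₁ ++ ys₂
    xs⊆ys₁ys₂ y y∈xs with ∈-++⁻ ys₁ (xxs⊆ys y (there y∈xs))
    ... | inj₁ y∈ys₁          = ∈-++⁺ˡ y∈ys₁
    ... | inj₂ (here refl)    = contradiction refl (All.lookup x∉xs y∈xs)
    ... | inj₂ (there y∈ys₂)  = ∈-++⁺ʳ ys₁ y∈ys₂
    ℤ∑-middle : ℤ∑.∑ (ys₁ ++ x ∷ ys₂) f ≡ f x ℤ.+ ℤ∑.∑ (ys₁ ++ ys₂) f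
    ℤ∑-middle = trans (ℤ∑.∑-++ ys₁ (x ∷ ys₂) f)
      (trans (swap (ℤ∑.∑ ys₁ f) (f x) (ℤ∑.∑ ys₂ f)) (cong (ℤ._+_ (f x)) (sym (ℤ∑.∑-++ ys₁ ys₂ f))))
      where
      swap : ∀ a b c → a ℤ.+ (b ℤ.+ c) ≡ b ℤ.+ (a ℤ.+ c)
      swap = solve-∀

χ : ∀ {p} {P : Set p} → Dec P → ℕ
χ (yes _) = 1
χ (no _)  = 0

χ≤1 : ∀ {p} {P : Set p} (P? : Dec P) → χ P? ≤ 1
χ≤1 (yes _) = s≤s z≤n
χ≤1 (no _)  = z≤n

χ-cong : ∀ {p q} {P : Set p} {Q : Set q} → (P → Q) → (Q → P) → (P? : Dec P) (Q? : Dec Q) → χ P? ≡ χ Q?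
χ-cong P⇒Q Q⇒P (yes p) (yes q) = refl
χ-cong P⇒Q Q⇒P (yes p) (no ¬q) = contradiction (P⇒Q p) ¬q
χ-cong P⇒Q Q⇒P (no ¬p) (yes q) = contradiction (Q⇒P q) ¬p
χ-cong P⇒Q Q⇒P (no ¬p) (no ¬q) = refl

χ-× : ∀ {p q} {P : Set p} {Q : Set q} (P? : Dec P) (Q? : Dec Q) → χ (P? ×-dec Q?) ≡ χ P? ℕ.* χ Q?
χ-× (yes _) (yes _) = refl
χ-× (yes _) (no _)  = refl
χ-× (no _)  _       = refl

χ-¬?-+ : ∀ {p} {P : Set p} (P? : Dec P) → χ (¬? P?) ℕ.+ χ P? ≡ 1
χ-¬?-+ (yes _) = refl
χ-¬?-+ (no _)  = refl

χ-idem : ∀ {p} {P : Set p} (P? : Dec P) → χ P? ℕ.* χ P? ≡ χ P?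
χ-idem (yes _) = refl
χ-idem (no _)  = refl

module _ {ℓ} {X : Set ℓ} where

  length-filter : ∀ {p} {P : X → Set p} (P? : ∀ x → Dec (P x)) xs → length (filter P? xs) ≡ ∑[ x ∈ xs ] χ (P? x)
  length-filter P? []       = refl
  length-filter P? (x ∷ xs) with P? x
  ... | yes _ = cong suc (length-filter P? xs)
  ... | no _  = length-filter P? xs

  module _ {p} {P : X → Set p} (P? : ∀ x → Dec (P x)) where

    count-none : ∀ xs → (∀ x → x ∈ xs → ¬ P x) → ∑[ x ∈ xs ] χ (P? x) ≡ 0
    count-none []       _  = refl
    count-none (x ∷ xs) ¬P with P? x
    ... | yes px = contradiction px (¬P x (here refl))
    ... | no _   = count-none xs (λ y → ¬P y ∘ there)

    private
      count-tail : ∀ {x xs} → Unique (x ∷ xs) → (∀ {y z} → P y → P z → y ≡ z) → P x →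
                   ∑[ y ∈ xs ] χ (P? y) ≡ 0
      count-tail (x∉xs ∷ _) P-unique px =
        count-none _ (λ y y∈xs py → All.lookup x∉xs y∈xs (P-unique px py))

    count-≤1 : ∀ {xs} → Unique xs → (∀ {y z} → P y → P z → y ≡ z) → ∑[ x ∈ xs ] χ (P? x) ≤ 1
    count-≤1 {[]}     _              _        = z≤n
    count-≤1 {x ∷ xs} !xxs@(_ ∷ !xs) P-unique with P? x
    ... | yes px = ℕₚ.≤-reflexive (cong suc (count-tail !xxs P-unique px))
    ... | no _   = count-≤1 !xs P-unique

    count-≡1 : ∀ {xs t} → Unique xs → (∀ {y z} → P y → P z → y ≡ z) → t ∈ xs → P t →
               ∑[ x ∈ xs ] χ (P? x) ≡ 1
    count-≡1 {x ∷ xs} !xxs@(_ ∷ !xs) P-unique t∈ pt with P? x | t∈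
    ... | yes px | _         = cong suc (count-tail !xxs P-unique px)
    ... | no ¬px | here refl = contradiction pt ¬px
    ... | no _   | there t∈xs = count-≡1 !xs P-unique t∈xs pt

∏-const : ∀ k m → ∏ {k} (λ _ → m) ≡ m ℕ.^ k
∏-const zero    m = refl
∏-const (suc k) m = cong (m ℕ.*_) (∏-const k m)

∏-mono-≤ : ∀ {k} {φ ψ : Fin k → ℕ} → (∀ i → φ i ≤ ψ i) → ∏ φ ≤ ∏ ψ
∏-mono-≤ {zero}  φ≤ψ = ℕₚ.≤-refl
∏-mono-≤ {suc k} φ≤ψ = ℕₚ.*-mono-≤ (φ≤ψ Fin.zero) (∏-mono-≤ (φ≤ψ ∘ Fin.suc))

module _ {ℓ} {X : Set ℓ} where

  vectors : List X → (n : ℕ) → List (Vec X n)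
  vectors xs zero    = [] ∷ []
  vectors xs (suc n) = concatMap (λ u → map (u ∷_) (vectors xs n)) xs

  ∈-vectors : ∀ {xs} → (∀ x → x ∈ xs) → ∀ {n} (v : Vec X n) → v ∈ vectors xs n
  ∈-vectors complete []      = here refl
  ∈-vectors complete (u ∷ v) = ∈-concatMap⁺ _ (Any.map (λ { refl → ∈-map⁺ (u ∷_) (∈-vectors complete v) }) (complete u))

  ∑-vectors-∷ : ∀ xs n (φ : Vec X (suc n) → ℕ) →
                ∑ (vectors xs (suc n)) φ ≡ ∑[ u ∈ xs ] ∑[ v ∈ vectors xs n ] φ (u ∷ v)
  ∑-vectors-∷ xs n φ = trans (∑-concatMap xs _ φ) (∑-cong xs (λ u → ∑-map (vectors xs n) (u ∷_) φ))

  ∑-vectors-∷ʳ : ∀ xs n (φ : Vec X (suc n) → ℕ) →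
                 ∑ (vectors xs (suc n)) φ ≡ ∑[ v ∈ vectors xs n ] ∑[ z ∈ xs ] φ (v ∷ʳ z)
  ∑-vectors-∷ʳ xs zero    φ = trans (∑-vectors-∷ xs zero φ)
    (trans (∑-cong xs (λ u → ℕₚ.+-identityʳ (φ (u ∷ [])))) (sym (ℕₚ.+-identityʳ _)))
  ∑-vectors-∷ʳ xs (suc n) φ = begin
    ∑ (vectors xs (suc (suc n))) φ                                 ≡⟨ ∑-vectors-∷ xs (suc n) φ ⟩
    ∑[ u ∈ xs ] ∑[ w ∈ vectors xs (suc n) ] φ (u ∷ w)              ≡⟨ ∑-cong xs (λ u → ∑-vectors-∷ʳ xs n (φ ∘ (u ∷_))) ⟩
    ∑[ u ∈ xs ] ∑[ v ∈ vectors xs n ] ∑[ z ∈ xs ] φ (u ∷ (v ∷ʳ z)) ≡⟨ sym (∑-vectors-∷ xs n _) ⟩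
    ∑[ v ∈ vectors xs (suc n) ] ∑[ z ∈ xs ] φ (v ∷ʳ z)              ∎
    where open ≡-Reasoning

  length-vectors : ∀ xs n → length (vectors xs n) ≡ length xs ℕ.^ n
  length-vectors xs zero    = refl
  length-vectors xs (suc n) = begin
    length (vectors xs (suc n))                  ≡⟨ length≡∑1 (vectors xs (suc n)) ⟩
    ∑ (vectors xs (suc n)) (λ _ → 1)             ≡⟨ ∑-vectors-∷ xs n _ ⟩
    ∑[ u ∈ xs ] ∑[ v ∈ vectors xs n ] 1          ≡⟨ ∑-cong xs (λ _ → sym (length≡∑1 (vectors xs n))) ⟩
    ∑[ u ∈ xs ] length (vectors xs n)            ≡⟨ ∑-const xs _ ⟩
    length xs ℕ.* length (vectors xs n)          ≡⟨ cong (length xs ℕ.*_) (length-vectors xs n) ⟩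
    length xs ℕ.^ suc n                          ∎
    where open ≡-Reasoning

  ∑-vectors-∏ : ∀ xs k (φ : Fin k → X → ℕ) →
                ∑[ a ∈ vectors xs k ] ∏ (λ i → φ i (lookup a i)) ≡ ∏ (λ i → ∑ xs (φ i))
  ∑-vectors-∏ xs zero    φ = refl
  ∑-vectors-∏ xs (suc k) φ = begin
    ∑[ a ∈ vectors xs (suc k) ] ∏ (λ i → φ i (lookup a i))
      ≡⟨ ∑-vectors-∷ xs k _ ⟩
    ∑[ u ∈ xs ] ∑[ a ∈ vectors xs k ] (φ Fin.zero u ℕ.* ∏ (λ i → φ (Fin.suc i) (lookup a i)))
      ≡⟨ ∑-cong xs (λ u → ∑-distribˡ (vectors xs k) (φ Fin.zero u) _) ⟩
    ∑[ u ∈ xs ] (φ Fin.zero u ℕ.* ∑[ a ∈ vectors xs k ] ∏ (λ i → φ (Fin.suc i) (lookup a i)))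
      ≡⟨ ∑-distribʳ xs _ (φ Fin.zero) ⟩
    ∑ xs (φ Fin.zero) ℕ.* ∑[ a ∈ vectors xs k ] ∏ (λ i → φ (Fin.suc i) (lookup a i))
      ≡⟨ cong (∑ xs (φ Fin.zero) ℕ.*_) (∑-vectors-∏ xs k (φ ∘ Fin.suc)) ⟩
    ∑ xs (φ Fin.zero) ℕ.* ∏ (λ i → ∑ xs (φ (Fin.suc i)))
      ∎
    where open ≡-Reasoning

  χ-≡-dec-tabulate : ∀ (_≟_ : DecidableEquality X) {n} (y : Vec X n) (t : Fin n → X) →
                     χ (Vecₚ.≡-dec _≟_ y (tabulate t)) ≡ ∏ (λ i → χ (lookup y i ≟ t i))
  χ-≡-dec-tabulate _≟_ []      t = refl
  χ-≡-dec-tabulate _≟_ (u ∷ y) t = begin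
    χ (Vecₚ.≡-dec _≟_ (u ∷ y) (tabulate t))
      ≡⟨ χ-cong Vecₚ.∷-injective (uncurry (cong₂ _∷_)) _ ((u ≟ t Fin.zero) ×-dec Vecₚ.≡-dec _≟_ y (tabulate (t ∘ Fin.suc))) ⟩
    χ ((u ≟ t Fin.zero) ×-dec Vecₚ.≡-dec _≟_ y (tabulate (t ∘ Fin.suc)))
      ≡⟨ χ-× (u ≟ t Fin.zero) _ ⟩
    χ (u ≟ t Fin.zero) ℕ.* χ (Vecₚ.≡-dec _≟_ y (tabulate (t ∘ Fin.suc)))
      ≡⟨ cong (χ (u ≟ t Fin.zero) ℕ.*_) (χ-≡-dec-tabulate _≟_ y (t ∘ Fin.suc)) ⟩
    χ (u ≟ t Fin.zero) ℕ.* ∏ (λ i → χ (lookup y i ≟ t (Fin.suc i)))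
      ∎
    where open ≡-Reasoning

lookup-∷ʳ-last : ∀ {ℓ} {X : Set ℓ} {n} (v : Vec X n) z → lookup (v ∷ʳ z) (Fin.fromℕ n) ≡ z
lookup-∷ʳ-last []      z = refl
lookup-∷ʳ-last (u ∷ v) z = lookup-∷ʳ-last v z

-- Finite fields

module FiniteFieldProperties {c} (F : FiniteField c) where
  open FiniteField F

  commutativeRing : CommutativeRing c c
  commutativeRing = record { isCommutativeRing = isCommutativeRing }

  open CommutativeRing commutativeRing
    using ( +-assoc; +-comm; +-group; +-commutativeSemigroup
          ; *-assoc; *-comm; *-identityˡ; *-identityʳ; zeroˡ; zeroʳ; distribˡ
          ; *-isCommutativeMonoid; *-commutativeSemigroup )
  open GroupProperties +-group using (∙-cancelˡ; ∙-cancelʳ; \\-leftDividesˡ; //-rightDividesˡ; x∙y⁻¹≈ε⇒x≈y)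
  open CommutativeSemigroupProperties +-commutativeSemigroup using (interchange; x∙yz≈y∙xz; xy∙z≈xz∙y)
  open CommutativeSemigroupProperties *-commutativeSemigroup using () renaming (interchange to *-interchange)

  q : ℕ
  q = size

  *-cancelˡ : ∀ {x y z} → x ≢ 0# → x * y ≡ x * z → y ≡ z
  *-cancelˡ {x} {y} {z} x≢0 xy≡xz with inverse x x≢0
  ... | x⁻¹ , xx⁻¹≡1 = begin
    y                 ≡⟨ sym (*-identityˡ y) ⟩
    1# * y            ≡⟨ cong (_* y) (trans (sym xx⁻¹≡1) (*-comm x x⁻¹)) ⟩
    x⁻¹ * x * y       ≡⟨ *-assoc x⁻¹ x y ⟩
    x⁻¹ * (x * y)     ≡⟨ cong (x⁻¹ *_) xy≡xz ⟩
    x⁻¹ * (x * z)     ≡⟨ sym (*-assoc x⁻¹ x z) ⟩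
    x⁻¹ * x * z       ≡⟨ cong (_* z) (trans (*-comm x⁻¹ x) xx⁻¹≡1) ⟩
    1# * z            ≡⟨ *-identityˡ z ⟩
    z                 ∎
    where open ≡-Reasoning

  *-cancelʳ : ∀ {x y z} → x ≢ 0# → y * x ≡ z * x → y ≡ z
  *-cancelʳ {x} {y} {z} x≢0 yx≡zx = *-cancelˡ x≢0 (trans (*-comm x y) (trans yx≡zx (*-comm z x)))

  *-nonzero : ∀ {x y} → x ≢ 0# → y ≢ 0# → x * y ≢ 0#
  *-nonzero {x} x≢0 y≢0 xy≡0 = y≢0 (*-cancelˡ x≢0 (trans xy≡0 (sym (zeroʳ x))))

  ^-nonzero : ∀ {x} n → x ≢ 0# → x ^ n ≢ 0#
  ^-nonzero zero    x≢0 1≡0 = 0≢1 (sym 1≡0)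
  ^-nonzero (suc n) x≢0     = *-nonzero x≢0 (^-nonzero n x≢0)

  0^n≡0 : ∀ {n} → 1 ≤ n → 0# ^ n ≡ 0#
  0^n≡0 (s≤s _) = zeroˡ _

  ^-distribˡ-+-* : ∀ x m n → x ^ (m ℕ.+ n) ≡ x ^ m * x ^ n
  ^-distribˡ-+-* x zero    n = sym (*-identityˡ _)
  ^-distribˡ-+-* x (suc m) n = trans (cong (x *_) (^-distribˡ-+-* x m n)) (sym (*-assoc x _ _))

  1^ : ∀ n → 1# ^ n ≡ 1#
  1^ zero    = refl
  1^ (suc n) = trans (*-identityˡ _) (1^ n)

  ^-*-assoc : ∀ x m n → (x ^ m) ^ n ≡ x ^ (m ℕ.* n)
  ^-*-assoc x m zero    = cong (x ^_) (sym (ℕₚ.*-zeroʳ m))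
  ^-*-assoc x m (suc n) = begin
    x ^ m * (x ^ m) ^ n      ≡⟨ cong (x ^ m *_) (^-*-assoc x m n) ⟩
    x ^ m * x ^ (m ℕ.* n)    ≡⟨ sym (^-distribˡ-+-* x m (m ℕ.* n)) ⟩
    x ^ (m ℕ.+ m ℕ.* n)      ≡⟨ cong (x ^_) (sym (ℕₚ.*-suc m n)) ⟩
    x ^ (m ℕ.* suc n)        ∎
    where open ≡-Reasoning

  product : List Carrier → Carrier
  product = List.foldr _*_ 1#

  product-nonzero : ∀ xs → (∀ x → x ∈ xs → x ≢ 0#) → product xs ≢ 0#
  product-nonzero []       _      1≡0 = 0≢1 (sym 1≡0)
  product-nonzero (x ∷ xs) xs≢0 = *-nonzero (xs≢0 x (here refl)) (product-nonzero xs (λ y → xs≢0 y ∘ there))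

  product-map-*ˡ : ∀ x xs → product (map (x *_) xs) ≡ x ^ length xs * product xs
  product-map-*ˡ x []       = sym (*-identityˡ 1#)
  product-map-*ˡ x (y ∷ xs) = trans (cong (x * y *_) (product-map-*ˡ x xs)) (*-interchange x y _ _)

  product-↭ : ∀ {xs ys} → xs ↭ ys → product xs ≡ product ys
  product-↭ = PermutationProperties.foldr-commMonoid (≡.setoid Carrier) *-isCommutativeMonoid ∘ ↭⇒↭ₛ

  nonzeros : List Carrier
  nonzeros = filter (λ x → ¬? (x ≟ 0#)) elements

  nonzeros-unique : Unique nonzeros
  nonzeros-unique = Uniqueₚ.filter⁺ _ elements-unique

  ∈-nonzeros⁺ : ∀ {x} → x ≢ 0# → x ∈ nonzeros
  ∈-nonzeros⁺ x≢0 = ∈-filter⁺ (λ x → ¬? (x ≟ 0#)) (elements-complete _) x≢0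

  ∈-nonzeros⁻ : ∀ {x} → x ∈ nonzeros → x ≢ 0#
  ∈-nonzeros⁻ x∈ = proj₂ (∈-filter⁻ (λ x → ¬? (x ≟ 0#)) {xs = elements} x∈)

  length-nonzeros : length nonzeros ≡ q ∸ 1
  length-nonzeros = begin
    length nonzeros                                            ≡⟨ sym (ℕₚ.m+n∸n≡m _ 1) ⟩
    length nonzeros ℕ.+ 1 ∸ 1                                  ≡⟨ cong (λ n → n ℕ.+ 1 ∸ 1) (length-filter _ elements) ⟩
    ∑[ x ∈ elements ] χ (¬? (x ≟ 0#)) ℕ.+ 1 ∸ 1                ≡⟨ cong (λ n → ∑[ x ∈ elements ] χ (¬? (x ≟ 0#)) ℕ.+ n ∸ 1) (sym count-zero) ⟩
    ∑[ x ∈ elements ] χ (¬? (x ≟ 0#)) ℕ.+ ∑[ x ∈ elements ] χ (x ≟ 0#) ∸ 1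
                                                               ≡⟨ cong (_∸ 1) (sym (∑-distrib-+ elements _ _)) ⟩
    ∑[ x ∈ elements ] (χ (¬? (x ≟ 0#)) ℕ.+ χ (x ≟ 0#)) ∸ 1    ≡⟨ cong (_∸ 1) (∑-cong elements (λ x → χ-¬?-+ (x ≟ 0#))) ⟩
    ∑[ x ∈ elements ] 1 ∸ 1                                    ≡⟨ cong (_∸ 1) (sym (length≡∑1 elements)) ⟩
    q ∸ 1                                                      ∎
    where
    open ≡-Reasoning
    count-zero : ∑[ x ∈ elements ] χ (x ≟ 0#) ≡ 1
    count-zero = count-≡1 (_≟ 0#) elements-unique (λ y≡0 z≡0 → trans y≡0 (sym z≡0)) (elements-complete 0#) refl

  map-*ˡ-nonzeros-↭ : ∀ {x} → x ≢ 0# → map (x *_) nonzeros ↭ nonzeros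
  map-*ˡ-nonzeros-↭ {x} x≢0 with inverse x x≢0
  ... | x⁻¹ , xx⁻¹≡1 = ∼bag⇒↭ (unique∧set⇒bag (Uniqueₚ.map⁺ (*-cancelˡ x≢0) nonzeros-unique) nonzeros-unique
                                              (mk⇔ ⊆nonzeros ⊇nonzeros))
    where
    ⊆nonzeros : ∀ {y} → y ∈ map (x *_) nonzeros → y ∈ nonzeros
    ⊆nonzeros y∈ with ∈-map⁻ (x *_) y∈
    ... | z , z∈ , refl = ∈-nonzeros⁺ (*-nonzero x≢0 (∈-nonzeros⁻ z∈))
    x⁻¹≢0 : x⁻¹ ≢ 0#
    x⁻¹≢0 x⁻¹≡0 = 0≢1 (trans (sym (zeroʳ x)) (trans (cong (x *_) (sym x⁻¹≡0)) xx⁻¹≡1))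
    x[x⁻¹y]≡y : ∀ y → x * (x⁻¹ * y) ≡ y
    x[x⁻¹y]≡y y = trans (sym (*-assoc x x⁻¹ y)) (trans (cong (_* y) xx⁻¹≡1) (*-identityˡ y))
    ⊇nonzeros : ∀ {y} → y ∈ nonzeros → y ∈ map (x *_) nonzeros
    ⊇nonzeros {y} y∈ = subst (_∈ map (x *_) nonzeros) (x[x⁻¹y]≡y y)
                         (∈-map⁺ (x *_) (∈-nonzeros⁺ (*-nonzero x⁻¹≢0 (∈-nonzeros⁻ y∈))))

  fermat : ∀ {x} → x ≢ 0# → x ^ (q ∸ 1) ≡ 1#
  fermat {x} x≢0 = subst (λ n → x ^ n ≡ 1#) length-nonzeros
    (*-cancelʳ (product-nonzero nonzeros (λ _ → ∈-nonzeros⁻)) (begin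
      x ^ length nonzeros * product nonzeros   ≡⟨ product-map-*ˡ x nonzeros ⟨
      product (map (x *_) nonzeros)            ≡⟨ product-↭ (map-*ˡ-nonzeros-↭ x≢0) ⟩
      product nonzeros                         ≡⟨ *-identityˡ _ ⟨
      1# * product nonzeros                    ∎))
    where open ≡-Reasoning

  fermat-multiple : ∀ {x} v → x ≢ 0# → x ^ (v ℕ.* (q ∸ 1)) ≡ 1#
  fermat-multiple {x} v x≢0 = begin
    x ^ (v ℕ.* (q ∸ 1))      ≡⟨ cong (x ^_) (ℕₚ.*-comm v (q ∸ 1)) ⟩
    x ^ ((q ∸ 1) ℕ.* v)      ≡⟨ sym (^-*-assoc x (q ∸ 1) v) ⟩
    (x ^ (q ∸ 1)) ^ v        ≡⟨ cong (_^ v) (fermat x≢0) ⟩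
    1# ^ v                   ≡⟨ 1^ v ⟩
    1#                       ∎
    where open ≡-Reasoning

  ^-injective : ∀ {b} → 1 ≤ b → gcd b (q ∸ 1) ≡ 1 → ∀ {x y} → x ^ b ≡ y ^ b → x ≡ y
  ^-injective {b} 1≤b gcd≡1 {x} {y} xᵇ≡yᵇ with x ≟ 0# | y ≟ 0#
  ... | yes refl | yes refl = refl
  ... | yes refl | no y≢0   = contradiction (trans (sym xᵇ≡yᵇ) (0^n≡0 1≤b)) (^-nonzero b y≢0)
  ... | no x≢0   | yes refl = contradiction (trans xᵇ≡yᵇ (0^n≡0 1≤b)) (^-nonzero b x≢0)
  ... | no x≢0   | no y≢0   with Bézout.identity (subst (GCD b (q ∸ 1)) gcd≡1 (gcd-GCD b (q ∸ 1)))
  ... | Bézout.+- u v 1+v[q-1]≡ub = trans (root x≢0) (trans (cong (_^ u) xᵇ≡yᵇ) (sym (root y≢0)))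
    where
    root : ∀ {w} → w ≢ 0# → w ≡ (w ^ b) ^ u
    root {w} w≢0 = begin
      w                          ≡⟨ sym (*-identityʳ w) ⟩
      w * 1#                     ≡⟨ cong (w *_) (sym (fermat-multiple v w≢0)) ⟩
      w ^ suc (v ℕ.* (q ∸ 1))    ≡⟨ cong (w ^_) 1+v[q-1]≡ub ⟩
      w ^ (u ℕ.* b)              ≡⟨ cong (w ^_) (ℕₚ.*-comm u b) ⟩
      w ^ (b ℕ.* u)              ≡⟨ sym (^-*-assoc w b u) ⟩
      (w ^ b) ^ u                ∎
      where open ≡-Reasoning
  ... | Bézout.-+ u v 1+ub≡v[q-1] = *-cancelʳ (^-nonzero u (^-nonzero b y≢0))
        (trans (cong (λ t → x * t ^ u) (sym xᵇ≡yᵇ)) (trans (inverse-power x≢0) (sym (inverse-power y≢0))))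
    where
    inverse-power : ∀ {w} → w ≢ 0# → w * (w ^ b) ^ u ≡ 1#
    inverse-power {w} w≢0 = begin
      w * (w ^ b) ^ u            ≡⟨ cong (w *_) (^-*-assoc w b u) ⟩
      w ^ suc (b ℕ.* u)          ≡⟨ cong (λ n → w ^ suc n) (ℕₚ.*-comm b u) ⟩
      w ^ suc (u ℕ.* b)          ≡⟨ cong (w ^_) 1+ub≡v[q-1] ⟩
      w ^ (v ℕ.* (q ∸ 1))        ≡⟨ fermat-multiple v w≢0 ⟩
      1#                         ∎
      where open ≡-Reasoning

  infixl 7 _·_
  _·_ : ∀ {n} → Vec Carrier n → Vec Carrier n → Carrier
  []      · []      = 0#
  (u ∷ v) · (δ ∷ D) = u * δ + v · D

  count-translates : ∀ c A → ∑[ z ∈ elements ] χ (c ≟ (A + z)) ≡ 1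
  count-translates c A =
    count-≡1 (λ z → c ≟ (A + z)) elements-unique translate-unique (elements-complete (- A + c)) (sym (\\-leftDividesˡ A c))
    where
    translate-unique : ∀ {y z} → c ≡ A + y → c ≡ A + z → y ≡ z
    translate-unique c≡A+y c≡A+z = ∙-cancelˡ A _ _ (trans (sym c≡A+y) c≡A+z)

  *-cross-cancel : ∀ {δ δ' u u'} → δ ≢ δ' → u * δ + u' * δ' ≡ u * δ' + u' * δ → u ≡ u'
  *-cross-cancel {δ} {δ'} {u} {u'} δ≢δ' cross = *-cancelʳ e≢0 (∙-cancelʳ (u * δ' + u' * δ') _ _ (begin
    u * e + (u * δ' + u' * δ')     ≡⟨ sym (+-assoc (u * e) _ _) ⟩
    u * e + u * δ' + u' * δ'       ≡⟨ cong (_+ u' * δ') (sym (distribˡ u e δ')) ⟩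
    u * (e + δ') + u' * δ'         ≡⟨ cong (λ t → u * t + u' * δ') δ≡e+δ' ⟨
    u * δ + u' * δ'                ≡⟨ cross ⟩
    u * δ' + u' * δ                ≡⟨ cong (λ t → u * δ' + u' * t) δ≡e+δ' ⟩
    u * δ' + u' * (e + δ')         ≡⟨ cong (_+_ (u * δ')) (distribˡ u' e δ') ⟩
    u * δ' + (u' * e + u' * δ')    ≡⟨ x∙yz≈y∙xz (u * δ') _ _ ⟩
    u' * e + (u * δ' + u' * δ')    ∎))
    where
    open ≡-Reasoning
    e = δ + - δ'
    e≢0 : e ≢ 0#
    e≢0 = δ≢δ' ∘ x∙y⁻¹≈ε⇒x≈y δ δ'
    δ≡e+δ' : δ ≡ e + δ'
    δ≡e+δ' = sym (//-rightDividesˡ δ' δ)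

  affine-injective : ∀ {δ δ' α β u u'} → δ ≢ δ' →
                     u * δ + α ≡ u * δ' + β → u' * δ + α ≡ u' * δ' + β → u ≡ u'
  affine-injective {δ} {δ'} {α} {β} {u} {u'} δ≢δ' eq eq' = *-cross-cancel δ≢δ' (∙-cancelʳ (α + β) _ _ (begin
    u * δ + u' * δ' + (α + β)      ≡⟨ interchange (u * δ) _ α β ⟩
    u * δ + α + (u' * δ' + β)      ≡⟨ cong₂ _+_ eq (sym eq') ⟩
    u * δ' + β + (u' * δ + α)      ≡⟨ interchange (u * δ') _ _ _ ⟩
    u * δ' + u' * δ + (β + α)      ≡⟨ cong (_+_ (u * δ' + u' * δ)) (+-comm β α) ⟩
    u * δ' + u' * δ + (α + β)      ∎))
    where open ≡-Reasoning

  count-affine-≤1 : ∀ {δ δ'} → δ ≢ δ' → ∀ s w s' w' →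
                    ∑[ u ∈ elements ] χ ((s + (u * δ + w)) ≟ (s' + (u * δ' + w'))) ≤ 1
  count-affine-≤1 {δ} {δ'} δ≢δ' s w s' w' =
    count-≤1 _ elements-unique (λ eq eq' → affine-injective δ≢δ' (rearrange eq) (rearrange eq'))
    where
    rearrange : ∀ {u} → s + (u * δ + w) ≡ s' + (u * δ' + w') → u * δ + (s + w) ≡ u * δ' + (s' + w')
    rearrange eq = trans (sym (x∙yz≈y∙xz s _ _)) (trans eq (x∙yz≈y∙xz s' _ _))

  χ-+-cancel : ∀ a s w s' w' → χ ((s + (a + w)) ≟ (s' + (a + w'))) ≡ χ ((s + w) ≟ (s' + w'))
  χ-+-cancel a s w s' w' = χ-cong cancel uncancel _ _
    where
    cancel : s + (a + w) ≡ s' + (a + w') → s + w ≡ s' + w'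
    cancel eq = ∙-cancelˡ a _ _ (trans (sym (x∙yz≈y∙xz s a w)) (trans eq (x∙yz≈y∙xz s' a w')))
    uncancel : s + w ≡ s' + w' → s + (a + w) ≡ s' + (a + w')
    uncancel eq = trans (x∙yz≈y∙xz s a w) (trans (cong (_+_ a) eq) (sym (x∙yz≈y∙xz s' a w')))

  hyperplane-≤ : ∀ {n} {D D' : Vec Carrier n} → D ≢ D' → ∀ s s' →
                 ∑[ v ∈ vectors elements n ] χ ((s + v · D) ≟ (s' + v · D')) ℕ.* q ≤ q ℕ.^ n
  hyperplane-≤ {zero}  {[]}    {[]}      []≢[]   s s' = contradiction refl []≢[]
  hyperplane-≤ {suc n} {δ ∷ D} {δ' ∷ D'} δD≢δ'D' s s' with δ ≟ δ'
  ... | yes refl = begin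
    ∑[ a ∈ vectors elements (suc n) ] χ ((s + a · (δ ∷ D)) ≟ (s' + a · (δ ∷ D'))) ℕ.* q
      ≡⟨ cong (ℕ._* q) (∑-vectors-∷ elements n _) ⟩
    ∑[ u ∈ elements ] ∑[ v ∈ vectors elements n ] χ ((s + (u * δ + v · D)) ≟ (s' + (u * δ + v · D'))) ℕ.* q
      ≡⟨ cong (ℕ._* q) (∑-cong elements (λ u → ∑-cong (vectors elements n) (λ v → χ-+-cancel (u * δ) s _ s' _))) ⟩
    ∑[ u ∈ elements ] C ℕ.* q                ≡⟨ cong (ℕ._* q) (∑-const elements C) ⟩
    q ℕ.* C ℕ.* q                            ≡⟨ ℕₚ.*-assoc q C q ⟩
    q ℕ.* (C ℕ.* q)                          ≤⟨ ℕₚ.*-monoʳ-≤ q (hyperplane-≤ (δD≢δ'D' ∘ cong (δ ∷_)) s s') ⟩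
    q ℕ.* q ℕ.^ n                            ∎
    where
    open ℕₚ.≤-Reasoning
    C = ∑[ v ∈ vectors elements n ] χ ((s + v · D) ≟ (s' + v · D'))
  ... | no δ≢δ' = begin
    ∑[ a ∈ vectors elements (suc n) ] χ ((s + a · (δ ∷ D)) ≟ (s' + a · (δ' ∷ D'))) ℕ.* q
      ≡⟨ cong (ℕ._* q) (trans (∑-vectors-∷ elements n _) (∑-comm elements (vectors elements n) _)) ⟩
    ∑[ v ∈ vectors elements n ] ∑[ u ∈ elements ] χ ((s + (u * δ + v · D)) ≟ (s' + (u * δ' + v · D'))) ℕ.* q
      ≤⟨ ℕₚ.*-monoˡ-≤ q (∑-mono-≤ (vectors elements n) (λ v → count-affine-≤1 δ≢δ' s (v · D) s' (v · D'))) ⟩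
    ∑[ v ∈ vectors elements n ] 1 ℕ.* q      ≡⟨ cong (ℕ._* q) (sym (length≡∑1 (vectors elements n))) ⟩
    length (vectors elements n) ℕ.* q        ≡⟨ cong (ℕ._* q) (length-vectors elements n) ⟩
    q ℕ.^ n ℕ.* q                            ≡⟨ ℕₚ.*-comm (q ℕ.^ n) q ⟩
    q ℕ.* q ℕ.^ n                            ∎
    where open ℕₚ.≤-Reasoning

  count-common-translates : ∀ c c' A A' →
    ∑[ z ∈ elements ] (χ (c ≟ (A + z)) ℕ.* χ (c' ≟ (A' + z))) ≤ χ ((c + A') ≟ (c' + A))
  count-common-translates c c' A A' with (c + A') ≟ (c' + A)
  ... | yes _ = ℕₚ.≤-trans (∑-mono-≤ elements (λ z → ℕₚ.*-monoʳ-≤ (χ (c ≟ (A + z))) (χ≤1 _)))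
                  (ℕₚ.≤-reflexive (trans (∑-cong elements (λ z → ℕₚ.*-identityʳ _)) (count-translates c A)))
  ... | no c+A'≢c'+A = ℕₚ.≤-reflexive (trans (∑-cong elements no-common) (∑-zero elements))
    where
    no-common : ∀ z → χ (c ≟ (A + z)) ℕ.* χ (c' ≟ (A' + z)) ≡ 0
    no-common z with c ≟ (A + z) | c' ≟ (A' + z)
    ... | yes refl | yes refl = contradiction
          (trans (xy∙z≈xz∙y A z A') (trans (cong (_+ z) (+-comm A A')) (sym (xy∙z≈xz∙y A' z A)))) c+A'≢c'+A
    ... | yes _    | no _     = refl
    ... | no _     | _        = refl

  module _ {n} (g : Vec Carrier (suc n) → Carrier) where

    level-set-size : ∀ (ℓ : Vec Carrier n → Carrier) → (∀ v z → g (v ∷ʳ z) ≡ ℓ v + z) →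
                     ∀ c → ∑[ a ∈ vectors elements (suc n) ] χ (c ≟ g a) ≡ q ℕ.^ n
    level-set-size ℓ g-translate c = begin
      ∑[ a ∈ vectors elements (suc n) ] χ (c ≟ g a)              ≡⟨ ∑-vectors-∷ʳ elements n _ ⟩
      ∑[ v ∈ vectors elements n ] ∑[ z ∈ elements ] χ (c ≟ g (v ∷ʳ z))
        ≡⟨ ∑-cong (vectors elements n) (λ v → trans
             (∑-cong elements (λ z → cong (λ t → χ (c ≟ t)) (g-translate v z))) (count-translates c (ℓ v))) ⟩
      ∑[ v ∈ vectors elements n ] 1                                ≡⟨ sym (length≡∑1 (vectors elements n)) ⟩
      length (vectors elements n)                                  ≡⟨ length-vectors elements n ⟩
      q ℕ.^ n                                                      ∎
      where open ≡-Reasoning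

    common-level-set-size-≤ : ∀ (g' : Vec Carrier (suc n) → Carrier) E E' (X X' : Vec Carrier n) →
      (∀ v z → g (v ∷ʳ z) ≡ (E + v · X) + z) → (∀ v z → g' (v ∷ʳ z) ≡ (E' + v · X') + z) → X ≢ X' →
      ∀ c c' → ∑[ a ∈ vectors elements (suc n) ] (χ (c ≟ g a) ℕ.* χ (c' ≟ g' a)) ℕ.* q ≤ q ℕ.^ n
    common-level-set-size-≤ g' E E' X X' g-translate g'-translate X≢X' c c' = begin
      ∑[ a ∈ vectors elements (suc n) ] (χ (c ≟ g a) ℕ.* χ (c' ≟ g' a)) ℕ.* q
        ≡⟨ cong (ℕ._* q) (∑-vectors-∷ʳ elements n _) ⟩
      ∑[ v ∈ vectors elements n ] ∑[ z ∈ elements ] (χ (c ≟ g (v ∷ʳ z)) ℕ.* χ (c' ≟ g' (v ∷ʳ z))) ℕ.* q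
        ≡⟨ cong (ℕ._* q) (∑-cong (vectors elements n) (λ v → ∑-cong elements (λ z →
             cong₂ ℕ._*_ (cong (λ t → χ (c ≟ t)) (g-translate v z)) (cong (λ t → χ (c' ≟ t)) (g'-translate v z))))) ⟩
      ∑[ v ∈ vectors elements n ] ∑[ z ∈ elements ] (χ (c ≟ (E + v · X + z)) ℕ.* χ (c' ≟ (E' + v · X' + z))) ℕ.* q
        ≤⟨ ℕₚ.*-monoˡ-≤ q (∑-mono-≤ (vectors elements n) (λ v → count-common-translates c c' _ _)) ⟩
      ∑[ v ∈ vectors elements n ] χ ((c + (E' + v · X')) ≟ (c' + (E + v · X))) ℕ.* q
        ≡⟨ cong (ℕ._* q) (∑-cong (vectors elements n) (λ v →
             χ-cong (λ eq → trans (+-assoc c E' _) (trans eq (sym (+-assoc c' E _))))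
                    (λ eq → trans (sym (+-assoc c E' _)) (trans eq (+-assoc c' E _))) _ _)) ⟩
      ∑[ v ∈ vectors elements n ] χ ((c + E' + v · X') ≟ (c' + E + v · X)) ℕ.* q
        ≤⟨ hyperplane-≤ (X≢X' ∘ sym) (c + E') (c' + E) ⟩
      q ℕ.^ n
        ∎
      where open ℕₚ.≤-Reasoning

-- Incidence bound from point degrees and codegrees

module IncidenceBound
  {p m r} {Point : Set p} {Param : Set m} {_∼_ : Point → Param → Set r}
  (_∼?_ : ∀ x a → Dec (x ∼ a)) (_≟ₚ_ : DecidableEquality Point)
  (Ω : List Param) (Ω-complete : ∀ a → a ∈ Ω)
  (K T : ℕ) (length-Ω : length Ω ≡ T ℕ.* K)
  (degree : ∀ x → ∑[ a ∈ Ω ] χ (x ∼? a) ≡ T)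
  (codegree : ∀ x y → x ≢ y → K ℕ.* ∑[ a ∈ Ω ] (χ (x ∼? a) ℕ.* χ (y ∼? a)) ≤ T)
  where

  incidences : List Point → List Param → ℕ
  incidences P V = length (filter (λ xa → proj₁ xa ∼? proj₂ xa) (cartesianProduct P V))

  module _ (P : List Point) (P-unique : Unique P) where

    N : Param → ℕ
    N a = ∑[ x ∈ P ] χ (x ∼? a)

    incidences≡∑N : ∀ V → incidences P V ≡ ∑ V N
    incidences≡∑N V = begin
      incidences P V                                     ≡⟨ length-filter _ (cartesianProduct P V) ⟩
      ∑[ xa ∈ cartesianProduct P V ] χ (proj₁ xa ∼? proj₂ xa) ≡⟨ ∑-cartesianProduct P V _ ⟩
      ∑[ x ∈ P ] ∑[ a ∈ V ] χ (x ∼? a)                   ≡⟨ ∑-comm P V _ ⟩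
      ∑ V N                                              ∎
      where open ≡-Reasoning

    first-moment : ∑ Ω N ≡ length P ℕ.* T
    first-moment = trans (sym (∑-comm P Ω _)) (trans (∑-cong P degree) (∑-const P T))

    codegree-≤ : ∀ x y → K ℕ.* ∑[ a ∈ Ω ] (χ (x ∼? a) ℕ.* χ (y ∼? a)) ≤ χ (y ≟ₚ x) ℕ.* (K ℕ.* T) ℕ.+ T
    codegree-≤ x y with y ≟ₚ x
    ... | yes refl = begin
      K ℕ.* ∑[ a ∈ Ω ] (χ (x ∼? a) ℕ.* χ (x ∼? a))  ≡⟨ cong (K ℕ.*_) (trans (∑-cong Ω (χ-idem ∘ (x ∼?_))) (degree x)) ⟩
      K ℕ.* T                                      ≤⟨ ℕₚ.m≤m+n (K ℕ.* T) T ⟩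
      K ℕ.* T ℕ.+ T                                ≡⟨ cong (ℕ._+ T) (ℕₚ.*-identityˡ (K ℕ.* T)) ⟨
      1 ℕ.* (K ℕ.* T) ℕ.+ T                        ∎
      where open ℕₚ.≤-Reasoning
    ... | no y≢x   = codegree x y (y≢x ∘ sym)

    second-moment : K ℕ.* ∑[ a ∈ Ω ] (N a ℕ.* N a) ≤ length P ℕ.* (K ℕ.* T ℕ.+ length P ℕ.* T)
    second-moment = begin
      K ℕ.* ∑[ a ∈ Ω ] (N a ℕ.* N a)
        ≡⟨ cong (K ℕ.*_) (∑-cong Ω (λ a → trans (sym (∑-distribʳ P (N a) _)) (∑-cong P (λ x → sym (∑-distribˡ P (χ (x ∼? a)) _))))) ⟩
      K ℕ.* ∑[ a ∈ Ω ] ∑[ x ∈ P ] ∑[ y ∈ P ] (χ (x ∼? a) ℕ.* χ (y ∼? a))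
        ≡⟨ cong (K ℕ.*_) (trans (∑-comm Ω P _) (∑-cong P (λ x → ∑-comm Ω P _))) ⟩
      K ℕ.* ∑[ x ∈ P ] ∑[ y ∈ P ] ∑[ a ∈ Ω ] (χ (x ∼? a) ℕ.* χ (y ∼? a))
        ≡⟨ trans (sym (∑-distribˡ P K _)) (∑-cong P (λ x → sym (∑-distribˡ P K _))) ⟩
      ∑[ x ∈ P ] ∑[ y ∈ P ] (K ℕ.* ∑[ a ∈ Ω ] (χ (x ∼? a) ℕ.* χ (y ∼? a)))
        ≤⟨ ∑-mono-≤ P (λ x → ∑-mono-≤ P (codegree-≤ x)) ⟩
      ∑[ x ∈ P ] ∑[ y ∈ P ] (χ (y ≟ₚ x) ℕ.* (K ℕ.* T) ℕ.+ T)
        ≡⟨ ∑-cong P (λ x → trans (∑-distrib-+ P _ _) (cong₂ ℕ._+_ (∑-distribʳ P (K ℕ.* T) _) (∑-const P T))) ⟩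
      ∑[ x ∈ P ] (∑[ y ∈ P ] χ (y ≟ₚ x) ℕ.* (K ℕ.* T) ℕ.+ length P ℕ.* T)
        ≤⟨ ∑-mono-≤ P (λ x → ℕₚ.+-monoˡ-≤ _ (ℕₚ.*-monoˡ-≤ (K ℕ.* T)
             (count-≤1 (_≟ₚ x) P-unique (λ y≡x z≡x → trans y≡x (sym z≡x))))) ⟩
      ∑[ x ∈ P ] (1 ℕ.* (K ℕ.* T) ℕ.+ length P ℕ.* T)
        ≡⟨ ∑-const P _ ⟩
      length P ℕ.* (1 ℕ.* (K ℕ.* T) ℕ.+ length P ℕ.* T)
        ≡⟨ cong (λ t → length P ℕ.* (t ℕ.+ length P ℕ.* T)) (ℕₚ.*-identityˡ (K ℕ.* T)) ⟩
      length P ℕ.* (K ℕ.* T ℕ.+ length P ℕ.* T)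
        ∎
      where open ℕₚ.≤-Reasoning

    κ π τ : ℤ
    κ = + K
    π = + length P
    τ = + T

    deviation : Param → ℤ
    deviation a = κ ℤ.* + N a ℤ.- π

    variance-≤ : ℤ∑.∑[ a ∈ Ω ] (deviation a ℤ.* deviation a) ℤ.≤ κ ℤ.* (π ℤ.* (κ ℤ.* τ))
    variance-≤ = begin
      ℤ∑.∑[ a ∈ Ω ] (deviation a ℤ.* deviation a)
        ≡⟨ ℤ∑-square Ω κ π (λ a → + N a) ⟩
      κ ℤ.* κ ℤ.* ℤ∑.∑[ a ∈ Ω ] (+ N a ℤ.* + N a) ℤ.- + 2 ℤ.* κ ℤ.* π ℤ.* ℤ∑.∑[ a ∈ Ω ] (+ N a) ℤ.+ + length Ω ℤ.* (π ℤ.* π)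
        ≡⟨ cong₂ (λ s t → κ ℤ.* κ ℤ.* s ℤ.- + 2 ℤ.* κ ℤ.* π ℤ.* t ℤ.+ + length Ω ℤ.* (π ℤ.* π)) ∑N²≡β ∑N≡πτ ⟩
      κ ℤ.* κ ℤ.* β ℤ.- + 2 ℤ.* κ ℤ.* π ℤ.* (π ℤ.* τ) ℤ.+ + length Ω ℤ.* (π ℤ.* π)
        ≡⟨ cong (λ n → κ ℤ.* κ ℤ.* β ℤ.- + 2 ℤ.* κ ℤ.* π ℤ.* (π ℤ.* τ) ℤ.+ n ℤ.* (π ℤ.* π))
                (trans (cong +_ length-Ω) (ℤₚ.pos-* T K)) ⟩
      κ ℤ.* κ ℤ.* β ℤ.- + 2 ℤ.* κ ℤ.* π ℤ.* (π ℤ.* τ) ℤ.+ τ ℤ.* κ ℤ.* (π ℤ.* π)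
        ≤⟨ ℤₚ.i≤i+j _ _ {{ℤ.nonNegative 0≤slack}} ⟩
      κ ℤ.* κ ℤ.* β ℤ.- + 2 ℤ.* κ ℤ.* π ℤ.* (π ℤ.* τ) ℤ.+ τ ℤ.* κ ℤ.* (π ℤ.* π) ℤ.+ slack
        ≡⟨ regroup κ π τ β ⟩
      κ ℤ.* (π ℤ.* (κ ℤ.* τ))
        ∎
      where
      open ℤₚ.≤-Reasoning
      β = + ∑[ a ∈ Ω ] (N a ℕ.* N a)
      ∑N²≡β : ℤ∑.∑[ a ∈ Ω ] (+ N a ℤ.* + N a) ≡ β
      ∑N²≡β = trans (ℤ∑.∑-cong Ω (λ a → sym (ℤₚ.pos-* (N a) (N a)))) (sym (pos-∑ Ω _))
      ∑N≡πτ : ℤ∑.∑[ a ∈ Ω ] (+ N a) ≡ π ℤ.* τ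
      ∑N≡πτ = trans (sym (pos-∑ Ω N)) (trans (cong +_ first-moment) (ℤₚ.pos-* (length P) T))
      κβ≤π[κτ+πτ] : κ ℤ.* β ℤ.≤ π ℤ.* (κ ℤ.* τ ℤ.+ π ℤ.* τ)
      κβ≤π[κτ+πτ] = subst₂ ℤ._≤_ (ℤₚ.pos-* K _) cast (ℤ.+≤+ second-moment)
        where
        cast : + (length P ℕ.* (K ℕ.* T ℕ.+ length P ℕ.* T)) ≡ π ℤ.* (κ ℤ.* τ ℤ.+ π ℤ.* τ)
        cast = trans (ℤₚ.pos-* (length P) _) (cong (π ℤ.*_) (trans (ℤₚ.pos-+ (K ℕ.* T) _)
                 (cong₂ ℤ._+_ (ℤₚ.pos-* K T) (ℤₚ.pos-* (length P) T))))
      slack = κ ℤ.* (π ℤ.* (κ ℤ.* τ ℤ.+ π ℤ.* τ) ℤ.- κ ℤ.* β)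
      0≤slack : ℤ.0ℤ ℤ.≤ slack
      0≤slack = subst (ℤ._≤ slack) (ℤₚ.*-zeroʳ κ) (ℤₚ.*-monoˡ-≤-nonNeg κ (ℤₚ.i≤j⇒0≤j-i κβ≤π[κτ+πτ]))
      regroup : ∀ κ π τ β →
        κ ℤ.* κ ℤ.* β ℤ.- + 2 ℤ.* κ ℤ.* π ℤ.* (π ℤ.* τ) ℤ.+ τ ℤ.* κ ℤ.* (π ℤ.* π)
          ℤ.+ κ ℤ.* (π ℤ.* (κ ℤ.* τ ℤ.+ π ℤ.* τ) ℤ.- κ ℤ.* β)
        ≡ κ ℤ.* (π ℤ.* (κ ℤ.* τ))
      regroup = solve-∀

    incidence-bound : ∀ V → Unique V →
      let D = + (K ℕ.* incidences P V) ℤ.- + (length P ℕ.* length V)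
      in D ℤ.* D ℤ.≤ + (T ℕ.* (K ℕ.* K) ℕ.* (length P ℕ.* length V))
    incidence-bound V V-unique = begin
      D ℤ.* D
        ≡⟨ cong₂ ℤ._*_ D≡∑deviation D≡∑deviation ⟩
      ℤ∑.∑ V deviation ℤ.* ℤ∑.∑ V deviation
        ≤⟨ cauchy-schwarz V deviation ⟩
      ν ℤ.* ℤ∑.∑[ a ∈ V ] (deviation a ℤ.* deviation a)
        ≤⟨ ℤₚ.*-monoˡ-≤-nonNeg ν (ℤ∑-⊆-≤ V-unique (λ a _ → Ω-complete a) (λ a → 0≤i*i (deviation a))) ⟩
      ν ℤ.* ℤ∑.∑[ a ∈ Ω ] (deviation a ℤ.* deviation a)
        ≤⟨ ℤₚ.*-monoˡ-≤-nonNeg ν variance-≤ ⟩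
      ν ℤ.* (κ ℤ.* (π ℤ.* (κ ℤ.* τ)))
        ≡⟨ regroup ν κ π τ ⟩
      τ ℤ.* (κ ℤ.* κ) ℤ.* (π ℤ.* ν)
        ≡⟨ cong₂ ℤ._*_ (cong (τ ℤ.*_) (ℤₚ.pos-* K K)) (ℤₚ.pos-* (length P) (length V)) ⟨
      τ ℤ.* + (K ℕ.* K) ℤ.* + (length P ℕ.* length V)
        ≡⟨ cong (ℤ._* + (length P ℕ.* length V)) (ℤₚ.pos-* T (K ℕ.* K)) ⟨
      + (T ℕ.* (K ℕ.* K)) ℤ.* + (length P ℕ.* length V)
        ≡⟨ ℤₚ.pos-* (T ℕ.* (K ℕ.* K)) _ ⟨
      + (T ℕ.* (K ℕ.* K) ℕ.* (length P ℕ.* length V))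
        ∎
      where
      open ℤₚ.≤-Reasoning
      ν = + length V
      D = + (K ℕ.* incidences P V) ℤ.- + (length P ℕ.* length V)
      D≡∑deviation : D ≡ ℤ∑.∑ V deviation
      D≡∑deviation = trans (cong (ℤ._- + (length P ℕ.* length V)) (ℤₚ.pos-* K (incidences P V)))
        (sym (trans (ℤ∑-affine V κ π (λ a → + N a)) (cong₂ (λ s t → κ ℤ.* s ℤ.- t) ∑N≡I νπ≡PV)))
        where
        ∑N≡I : ℤ∑.∑[ a ∈ V ] (+ N a) ≡ + incidences P V
        ∑N≡I = trans (sym (pos-∑ V N)) (cong +_ (sym (incidences≡∑N V)))
        νπ≡PV : ν ℤ.* π ≡ + (length P ℕ.* length V)
        νπ≡PV = trans (ℤₚ.*-comm ν π) (sym (ℤₚ.pos-* (length P) (length V)))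
      regroup : ∀ ν κ π τ → ν ℤ.* (κ ℤ.* (π ℤ.* (κ ℤ.* τ))) ≡ τ ℤ.* (κ ℤ.* κ) ℤ.* (π ℤ.* ν)
      regroup = solve-∀

-- The varieties V_{a_1,…,a_k}

module Varieties {c} (F : FiniteField c) {d k} (h : Fin k → Poly F d) (b : Fin k → Vec ℕ d)
  (1≤b : ∀ i j → 1 ≤ lookup (b i) j) (b-coprime : ∀ i j → gcd (lookup (b i) j) (FiniteField.size F ∸ 1) ≡ 1)
  where
  open FiniteField F
  open FiniteFieldProperties F
  open Setup F h b

  powers : Fin k → Vec Carrier d → Vec Carrier d
  powers i x = tabulate (λ j → lookup x j ^ lookup (b i) j)

  powers-injective : ∀ i {x x'} → powers i x ≡ powers i x' → x ≡ x'
  powers-injective i {x} {x'} eq = begin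
    x                       ≡⟨ Vecₚ.tabulate∘lookup x ⟨
    tabulate (lookup x)     ≡⟨ Vecₚ.tabulate-cong (λ j → ^-injective (1≤b i j) (b-coprime i j) (lookup-powers j)) ⟩
    tabulate (lookup x')    ≡⟨ Vecₚ.tabulate∘lookup x' ⟩
    x'                      ∎
    where
    open ≡-Reasoning
    lookup-powers : ∀ j → lookup x j ^ lookup (b i) j ≡ lookup x' j ^ lookup (b i) j
    lookup-powers j = trans (sym (Vecₚ.lookup∘tabulate _ j))
                        (trans (cong (λ w → lookup w j) eq) (Vecₚ.lookup∘tabulate _ j))

  sumFin-∷ʳ : ∀ {n} (v : Vec Carrier n) z (w : Fin n → Carrier) →
              sumFin (λ j → lookup (v ∷ʳ z) (Fin.inject₁ j) * w j) ≡ v · tabulate w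
  sumFin-∷ʳ []      z w = refl
  sumFin-∷ʳ (u ∷ v) z w = cong (_+_ (u * w Fin.zero)) (sumFin-∷ʳ v z (w ∘ Fin.suc))

  f-∷ʳ : ∀ i x v z → f i x (v ∷ʳ z) ≡ eval F (h i) x + v · powers i x + z
  f-∷ʳ i x v z = cong₂ (λ s t → eval F (h i) x + s + t) (sumFin-∷ʳ v z _) (lookup-∷ʳ-last v z)

  Ω : List Param
  Ω = vectors (vectors elements (suc d)) k

  length-Ω : length Ω ≡ q ℕ.^ (d ℕ.* k) ℕ.* q ℕ.^ k
  length-Ω = begin
    length Ω                              ≡⟨ length-vectors _ k ⟩
    length (vectors elements (suc d)) ℕ.^ k ≡⟨ cong (ℕ._^ k) (length-vectors elements (suc d)) ⟩
    (q ℕ.^ suc d) ℕ.^ k                   ≡⟨ ℕₚ.^-*-assoc q (suc d) k ⟩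
    q ℕ.^ (k ℕ.+ d ℕ.* k)                 ≡⟨ ℕₚ.^-distribˡ-+-* q k (d ℕ.* k) ⟩
    q ℕ.^ k ℕ.* q ℕ.^ (d ℕ.* k)           ≡⟨ ℕₚ.*-comm (q ℕ.^ k) _ ⟩
    q ℕ.^ (d ℕ.* k) ℕ.* q ℕ.^ k           ∎
    where open ≡-Reasoning

  χ-∈V : ∀ x y a → χ ((x , y) ∈V? a) ≡ ∏ (λ i → χ (lookup y i ≟ f i x (lookup a i)))
  χ-∈V x y a = χ-≡-dec-tabulate _≟_ y (λ i → f i x (lookup a i))

  degree : ∀ p → ∑[ a ∈ Ω ] χ (p ∈V? a) ≡ q ℕ.^ (d ℕ.* k)
  degree (x , y) = begin
    ∑[ a ∈ Ω ] χ ((x , y) ∈V? a)                                        ≡⟨ ∑-cong Ω (χ-∈V x y) ⟩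
    ∑[ a ∈ Ω ] ∏ (λ i → χ (lookup y i ≟ f i x (lookup a i)))            ≡⟨ ∑-vectors-∏ _ k _ ⟩
    ∏ (λ i → ∑[ aᵢ ∈ vectors elements (suc d) ] χ (lookup y i ≟ f i x aᵢ))
      ≡⟨ ∏-cong (λ i → level-set-size (f i x) _ (f-∷ʳ i x) (lookup y i)) ⟩
    ∏ {k} (λ _ → q ℕ.^ d)                                               ≡⟨ ∏-const k _ ⟩
    (q ℕ.^ d) ℕ.^ k                                                     ≡⟨ ℕₚ.^-*-assoc q d k ⟩
    q ℕ.^ (d ℕ.* k)                                                     ∎
    where open ≡-Reasoning

  codegree : ∀ p p' → p ≢ p' → q ℕ.^ k ℕ.* ∑[ a ∈ Ω ] (χ (p ∈V? a) ℕ.* χ (p' ∈V? a)) ≤ q ℕ.^ (d ℕ.* k)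
  codegree (x , y) (x' , y') p≢p' with Vecₚ.≡-dec _≟_ x x'
  ... | yes refl = ℕₚ.≤-trans (ℕₚ.≤-reflexive (trans (cong (q ℕ.^ k ℕ.*_) (∑-zero-on Ω)) (ℕₚ.*-zeroʳ (q ℕ.^ k)))) z≤n
    where
    ∑-zero-on : ∀ as → ∑[ a ∈ as ] (χ ((x , y) ∈V? a) ℕ.* χ ((x , y') ∈V? a)) ≡ 0
    ∑-zero-on as = trans (∑-cong as disjoint) (∑-zero as)
      where
      disjoint : ∀ a → χ ((x , y) ∈V? a) ℕ.* χ ((x , y') ∈V? a) ≡ 0
      disjoint a with (x , y) ∈V? a | (x , y') ∈V? a
      ... | yes y≡ | yes y'≡ = contradiction (cong (x ,_) (trans y≡ (sym y'≡))) p≢p'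
      ... | yes _  | no _    = refl
      ... | no _   | _       = refl
  ... | no x≢x' = begin
    q ℕ.^ k ℕ.* ∑[ a ∈ Ω ] (χ ((x , y) ∈V? a) ℕ.* χ ((x' , y') ∈V? a))
      ≡⟨ cong (q ℕ.^ k ℕ.*_) (∑-cong Ω (λ a → trans (cong₂ ℕ._*_ (χ-∈V x y a) (χ-∈V x' y' a))
           (sym (∏-distrib-* (λ i → χ (lookup y i ≟ f i x (lookup a i))) (λ i → χ (lookup y' i ≟ f i x' (lookup a i))))))) ⟩
    q ℕ.^ k ℕ.* ∑[ a ∈ Ω ] ∏ (λ i → χ (lookup y i ≟ f i x (lookup a i)) ℕ.* χ (lookup y' i ≟ f i x' (lookup a i)))
      ≡⟨ cong (q ℕ.^ k ℕ.*_) (∑-vectors-∏ _ k _) ⟩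
    q ℕ.^ k ℕ.* ∏ φ
      ≡⟨ cong (ℕ._* ∏ φ) (∏-const k q) ⟨
    ∏ {k} (λ _ → q) ℕ.* ∏ φ
      ≡⟨ ℕₚ.*-comm (∏ {k} (λ _ → q)) (∏ φ) ⟩
    ∏ φ ℕ.* ∏ {k} (λ _ → q)
      ≡⟨ ∏-distrib-* φ (λ _ → q) ⟨
    ∏ (λ i → φ i ℕ.* q)
      ≤⟨ ∏-mono-≤ (λ i → common-level-set-size-≤ (f i x) (f i x') _ _ (powers i x) (powers i x')
                           (f-∷ʳ i x) (f-∷ʳ i x') (x≢x' ∘ powers-injective i) (lookup y i) (lookup y' i)) ⟩
    ∏ {k} (λ _ → q ℕ.^ d)
      ≡⟨ ∏-const k _ ⟩
    (q ℕ.^ d) ℕ.^ k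
      ≡⟨ ℕₚ.^-*-assoc q d k ⟩
    q ℕ.^ (d ℕ.* k)
      ∎
    where
    open ℕₚ.≤-Reasoning
    φ : Fin k → ℕ
    φ i = ∑[ aᵢ ∈ vectors elements (suc d) ] (χ (lookup y i ≟ f i x aᵢ) ℕ.* χ (lookup y' i ≟ f i x' aᵢ))

  open IncidenceBound _∈V?_ (×-≡-dec (Vecₚ.≡-dec _≟_) (Vecₚ.≡-dec _≟_)) Ω (∈-vectors (∈-vectors elements-complete))
                      (q ℕ.^ k) (q ℕ.^ (d ℕ.* k)) length-Ω degree codegree
    public using (incidence-bound)

theorem1p3 : ∀ {c} (F : FiniteField c) → OddPrimePower (FiniteField.size F) →
    (d k : ℕ) → 1 ≤ d → 1 ≤ k →
    (h : Fin k → Poly F d) → (∀ i → DegreeAtMost F (FiniteField.size F ∸ 1) (h i)) →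
    (b : Fin k → Vec ℕ d) →
    (∀ i j → 1 ≤ lookup (b i) j) →
    (∀ i j → gcd (lookup (b i) j) (FiniteField.size F ∸ 1) ≡ 1) →
    (P : List (Setup.Point F {d} {k} h b)) → Unique P →
    (V : List (Setup.Param F {d} {k} h b)) → Unique V →
    let q = FiniteField.size F
        I = Setup.incidences F {d} {k} h b P V
        PV = length P ℕ.* length V
        D = + (q ℕ.^ k ℕ.* I) ℤ.- + PV
    in D ℤ.* D ℤ.≤ + (q ℕ.^ (d ℕ.* k) ℕ.* q ℕ.^ (2 ℕ.* k) ℕ.* PV)
theorem1p3 F _ d k _ _ h _ b 1≤b b-coprime P P-unique V V-unique =
  subst (λ m → D ℤ.* D ℤ.≤ + (q ℕ.^ (d ℕ.* k) ℕ.* m ℕ.* (length P ℕ.* length V))) (sym q^2k≡q^k*q^k)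
    (Varieties.incidence-bound F h b 1≤b b-coprime P P-unique V V-unique)
  where
  q = FiniteField.size F
  D = + (q ℕ.^ k ℕ.* Setup.incidences F h b P V) ℤ.- + (length P ℕ.* length V)
  q^2k≡q^k*q^k : q ℕ.^ (2 ℕ.* k) ≡ q ℕ.^ k ℕ.* q ℕ.^ k
  q^2k≡q^k*q^k = trans (ℕₚ.^-distribˡ-+-* q k (k ℕ.+ 0)) (cong (λ n → q ℕ.^ k ℕ.* q ℕ.^ n) (ℕₚ.+-identityʳ k))
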